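{- Let $G$ be a finite simple graph, let $t<0$ and $k>0$ be integers, and write $k=i-mt$ with integers $m\ge 0$ and $1\le i\le -t$. Run the following procedure: set $H\gets G$; for $j=0,1,\dots,m$ in turn, delete from $H$ (simultaneously) all vertices whose degree in the current graph $H$ is smaller than $i-jt$, and let $H$ be the resulting graph. Let $G_0\ge G_1\ge\cdots$ be the maximal D-chain of order $t$ of $G$. Then the final graph $H$ equals $G_k$.
   Context: For graphs, $H\le G$ means $H$ is a subgraph of $G$, and $H<G$ means $H\le G$ and $H\neq G$. A D-chain of order $t$ (for an integer $t$) of $G$ is a chain $L\colon G_0\ge G_1\ge\cdots\ge G_k$ of nonempty subgraphs of $G$ such that $G_0=G$, each $G_i$ ($1\le i\le k$) is a vertex-induced subgraph of $G_{i-1}$, and for every $0\le i\le k$ every vertex $v$ of $G_i$ has at least $i$ neighbors in $G_j$, where $j=\max\{0,i+t\}$. The number $k$ is the length of the chain. A D-chain $L\colon G_0\ge\cdots\ge G_k$ of order $t$ is maximal if (i) there is no D-chain of order $t$ of length greater than $k$, and (ii) there is no D-chain $G'_0\ge G'_1\ge\cdots\ge G'_k$ of order $t$ with $G_i<G'_i$ for some $1\le i\le k$. For every integer $t\le 0$ the maximal D-chain of order $t$ of $G$ exists and is unique. -}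

module Defs where

open import Data.Nat using (ℕ; zero; suc; _+_; _*_; _∸_; _≤_; _<_; _≤ᵇ_)
open import Data.Bool using (Bool; true; false; _∧_)
open import Data.Fin using (Fin)
open import Data.Fin.Subset using (Subset; _∈_; _⊆_; _⊂_; _∩_; ∣_∣; ⊤; Nonempty)
open import Data.Vec using (tabulate; lookup)
open import Data.Product using (∃; Σ; _×_)
open import Relation.Binary.PropositionalEquality using (_≡_)
open import Relation.Nullary using (¬_)

record Graph (n : ℕ) : Set where
  field
    adj    : Fin n → Fin n → Bool
    sym    : ∀ u v → adj u v ≡ adj v u
    irrefl : ∀ v → adj v v ≡ false
open Graph public

-- Vertex-induced subgraphs of G are identified with their vertex sets
-- (Subset n); for induced subgraphs H, H' of G, H ≤ H' iff V(H) ⊆ V(H').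

nbr : ∀ {n} → Graph n → Fin n → Subset n
nbr G v = tabulate (adj G v)

-- number of neighbours of v lying in the vertex set S
-- (= degree of v in the induced subgraph G[S] when v ∈ S)
degIn : ∀ {n} → Graph n → Subset n → Fin n → ℕ
degIn G S v = ∣ S ∩ nbr G v ∣

-- D-chain of order t = - s  (s : ℕ, so t ≤ 0) of G, of length len.
-- G_i is given by the vertex set (set i), for i ≤ len.
-- For t = -s, max{0, i+t} = i ∸ s.
record DChain {n : ℕ} (G : Graph n) (s : ℕ) : Set where
  field
    len      : ℕ
    set      : ℕ → Subset n
    first    : set 0 ≡ ⊤
    nonempty : ∀ i → i ≤ len → Nonempty (set i)
    induced  : ∀ i → suc i ≤ len → set (suc i) ⊆ set i
    degree   : ∀ i → i ≤ len → ∀ v → v ∈ set i → i ≤ degIn G (set (i ∸ s)) v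
open DChain public

record Maximal {n : ℕ} {G : Graph n} {s : ℕ} (L : DChain G s) : Set where
  field
    longest : ∀ (L' : DChain G s) → len L' ≤ len L
    noLarger : ∀ (L' : DChain G s) → len L' ≡ len L →
               ¬ (Σ ℕ λ i → 1 ≤ i × i ≤ len L × set L i ⊂ set L' i)
open Maximal public

prune : ∀ {n} → Graph n → ℕ → Subset n → Subset n
prune G d H = tabulate λ v → lookup H v ∧ (d ≤ᵇ degIn G H v)

-- the procedure: start from H = G, and for j = 0, 1, …, m apply
-- prune with threshold i - j t = i + j * s
procedure : ∀ {n} → Graph n → (s i m : ℕ) → Subset n
procedure G s i zero    = prune G i ⊤
procedure G s i (suc m) = prune G (i + suc m * s) (procedure G s i m)

-- Greedily taking each level as large as allowed, G_k := {v ∈ G_{k-1} : v has ≥ k neighbours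
-- in G_{max(0,k+t)}}, yields a chain that contains every D-chain levelwise; hence the
-- maximal D-chain is exactly its nonempty initial segment. In the greedy chain one may
-- jump from level k to any level l ≥ k, keeping the vertices of G_k with ≥ l neighbours in
-- G_{max(0,l+t)}. For l ≤ -t this reference level is G itself, and for l = k - t it is G_k,
-- which are precisely the first and the later rounds of the procedure.
module Submission where

open import Defs hiding (sym)
open import Data.Bool using (Bool; T; _∧_)
open import Data.Bool.Properties using (T-≡; T-∧)
open import Data.Empty using (⊥-elim)
open import Data.Fin using (Fin)
open import Data.Fin.Subset using (Subset; _∈_; _⊆_; ⊤; ⊥; Nonempty)
open import Data.Fin.Subset.Properties
  using (⊆-antisym; p⊆q⇒∣p∣≤∣q∣; x∈p∩q⁺; x∈p∩q⁻; _∈?_; ∈⊤; Empty-unique)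
open import Data.Nat using (ℕ; zero; suc; _+_; _*_; _∸_; _≤_; _<_; _≤′_; ≤′-refl; ≤′-step; _≤ᵇ_; z≤n; s≤s)
open import Data.Nat.Induction using (<-rec)
open import Data.Nat.Properties
  using (≤-refl; ≤-trans; n≤1+n; m≤m+n; m∸n≤m; ≤⇒≤′; ≤ᵇ⇒≤; ≤⇒≤ᵇ; <⇒≱; ∸-monoʳ-≤;
         m≤n⇒m∸n≡0; m+n∸n≡m; +-identityʳ; +-comm; +-assoc)
open import Data.Product using (_×_; _,_)
open import Data.Vec using (tabulate; lookup)
open import Data.Vec.Properties using (lookup∘tabulate; []=⇒lookup; lookup⇒[]=)
open import Function.Bundles using (Equivalence)
open import Relation.Binary.PropositionalEquality using (_≡_; refl; sym; trans; cong; cong₂; module ≡-Reasoning)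
open import Relation.Nullary using (yes; no)

∈⇒T-lookup : ∀ {n} {P : Subset n} {v} → v ∈ P → T (lookup P v)
∈⇒T-lookup v∈P = Equivalence.from T-≡ ([]=⇒lookup v∈P)

T-lookup⇒∈ : ∀ {n} {P : Subset n} {v} → T (lookup P v) → v ∈ P
T-lookup⇒∈ {P = P} {v} t = lookup⇒[]= v P (Equivalence.to T-≡ t)

∈-tabulate⁻ : ∀ {n} {f : Fin n → Bool} {v} → v ∈ tabulate f → T (f v)
∈-tabulate⁻ {f = f} {v} v∈ = Equivalence.from T-≡ (trans (sym (lookup∘tabulate f v)) ([]=⇒lookup v∈))

∈-tabulate⁺ : ∀ {n} {f : Fin n → Bool} {v} → T (f v) → v ∈ tabulate f
∈-tabulate⁺ {f = f} {v} t = lookup⇒[]= v (tabulate f) (trans (lookup∘tabulate f v) (Equivalence.to T-≡ t))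

module _ {n} (G : Graph n) where

  -- prune G d H is definitionally pruneBy G d H H
  pruneBy : ℕ → Subset n → Subset n → Subset n
  pruneBy d D P = tabulate λ v → lookup P v ∧ (d ≤ᵇ degIn G D v)

  ∈-pruneBy⁻ : ∀ d D P {v} → v ∈ pruneBy d D P → v ∈ P × d ≤ degIn G D v
  ∈-pruneBy⁻ d D P {v} v∈ with Equivalence.to T-∧ (∈-tabulate⁻ v∈)
  ... | v∈P , d≤deg = T-lookup⇒∈ v∈P , ≤ᵇ⇒≤ d (degIn G D v) d≤deg

  ∈-pruneBy⁺ : ∀ d D P {v} → v ∈ P → d ≤ degIn G D v → v ∈ pruneBy d D P
  ∈-pruneBy⁺ _ _ _ v∈P d≤deg = ∈-tabulate⁺ (Equivalence.from T-∧ (∈⇒T-lookup v∈P , ≤⇒≤ᵇ d≤deg))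

  degIn-mono : ∀ {S S′ v} → S ⊆ S′ → degIn G S v ≤ degIn G S′ v
  degIn-mono {S} {S′} {v} S⊆S′ = p⊆q⇒∣p∣≤∣q∣ λ x∈ →
    let x∈S , x∈N = x∈p∩q⁻ S (nbr G v) x∈ in x∈p∩q⁺ (S⊆S′ x∈S , x∈N)

module Greedy {n} (G : Graph n) (s′ : ℕ) where

  s : ℕ
  s = suc s′

  -- the level k is computed with fuel f ≥ k; note suc k ∸ s = k ∸ s′
  greedyᶠ : ℕ → ℕ → Subset n
  greedyᶠ _       zero    = ⊤
  greedyᶠ zero    (suc k) = ⊤
  greedyᶠ (suc f) (suc k) = pruneBy G (suc k) (greedyᶠ f (k ∸ s′)) (greedyᶠ f k)

  greedyᶠ-fuel : ∀ f g k → k ≤ f → k ≤ g → greedyᶠ f k ≡ greedyᶠ g k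
  greedyᶠ-fuel f       g       zero    _         _         = refl
  greedyᶠ-fuel (suc f) (suc g) (suc k) (s≤s k≤f) (s≤s k≤g) =
    cong₂ (pruneBy G (suc k))
          (greedyᶠ-fuel f g (k ∸ s′) (≤-trans (m∸n≤m k s′) k≤f) (≤-trans (m∸n≤m k s′) k≤g))
          (greedyᶠ-fuel f g k k≤f k≤g)

  greedy : ℕ → Subset n
  greedy k = greedyᶠ k k

  greedy-suc : ∀ k → greedy (suc k) ≡ pruneBy G (suc k) (greedy (k ∸ s′)) (greedy k)
  greedy-suc k = cong (λ D → pruneBy G (suc k) D (greedy k))
                      (greedyᶠ-fuel k (k ∸ s′) (k ∸ s′) (m∸n≤m k s′) ≤-refl)

  ∈-greedy-suc⁻ : ∀ {k v} → v ∈ greedy (suc k) → v ∈ greedy k × suc k ≤ degIn G (greedy (k ∸ s′)) v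
  ∈-greedy-suc⁻ {k} v∈ rewrite greedy-suc k = ∈-pruneBy⁻ G (suc k) (greedy (k ∸ s′)) (greedy k) v∈

  ∈-greedy-suc⁺ : ∀ {k v} → v ∈ greedy k → suc k ≤ degIn G (greedy (k ∸ s′)) v → v ∈ greedy (suc k)
  ∈-greedy-suc⁺ {k} v∈ deg rewrite greedy-suc k = ∈-pruneBy⁺ G (suc k) (greedy (k ∸ s′)) (greedy k) v∈ deg

  greedy-suc-⊆ : ∀ k → greedy (suc k) ⊆ greedy k
  greedy-suc-⊆ k v∈ with ∈-greedy-suc⁻ v∈
  ... | v∈greedy-k , _ = v∈greedy-k

  greedy-antitone′ : ∀ {k l} → k ≤′ l → greedy l ⊆ greedy k
  greedy-antitone′ ≤′-refl             = λ v∈ → v∈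
  greedy-antitone′ (≤′-step {l} k≤′l) = λ v∈ → greedy-antitone′ k≤′l (greedy-suc-⊆ l v∈)

  greedy-antitone : ∀ {k l} → k ≤ l → greedy l ⊆ greedy k
  greedy-antitone k≤l = greedy-antitone′ (≤⇒≤′ k≤l)

  greedy-degree : ∀ {k v} → v ∈ greedy k → k ≤ degIn G (greedy (k ∸ s)) v
  greedy-degree {zero}  _  = z≤n
  greedy-degree {suc k} v∈ with ∈-greedy-suc⁻ v∈
  ... | _ , deg = deg

  -- the degree demanded at level l also meets the weaker demands at the levels between k and l
  ∈-greedy-climb : ∀ {k l v} → k ≤′ l → v ∈ greedy k → l ≤ degIn G (greedy (l ∸ s)) v → v ∈ greedy l
  ∈-greedy-climb ≤′-refl v∈ _ = v∈
  ∈-greedy-climb (≤′-step {l} k≤′l) v∈ deg =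
    ∈-greedy-suc⁺ (∈-greedy-climb k≤′l v∈ (≤-trans (n≤1+n l) (≤-trans deg (degIn-mono G lower⊆))))
                  deg
    where
    lower⊆ : greedy (l ∸ s′) ⊆ greedy (l ∸ s)
    lower⊆ = greedy-antitone (∸-monoʳ-≤ l (n≤1+n s′))

  greedy-skip : ∀ {k l} → k ≤ l → greedy l ≡ pruneBy G l (greedy (l ∸ s)) (greedy k)
  greedy-skip {k} {l} k≤l = ⊆-antisym
    (λ v∈ → ∈-pruneBy⁺ G l (greedy (l ∸ s)) (greedy k) (greedy-antitone k≤l v∈) (greedy-degree v∈))
    (λ v∈ → let v∈k , deg = ∈-pruneBy⁻ G l (greedy (l ∸ s)) (greedy k) v∈ in ∈-greedy-climb (≤⇒≤′ k≤l) v∈k deg)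

  greedy≡prune-⊤ : ∀ {j} → j ≤ s → greedy j ≡ prune G j ⊤
  greedy≡prune-⊤ {j} j≤s =
    trans (greedy-skip {l = j} z≤n) (cong (λ l → pruneBy G j (greedy l) ⊤) (m≤n⇒m∸n≡0 j≤s))

  greedy-+s : ∀ k → greedy (k + s) ≡ prune G (k + s) (greedy k)
  greedy-+s k =
    trans (greedy-skip (m≤m+n k s)) (cong (λ l → pruneBy G (k + s) (greedy l) (greedy k)) (m+n∸n≡m k s))

  procedure≡greedy : ∀ {i} m → i ≤ s → procedure G s i m ≡ greedy (i + m * s)
  procedure≡greedy {i} zero    i≤s = trans (sym (greedy≡prune-⊤ i≤s)) (cong greedy (sym (+-identityʳ i)))
  procedure≡greedy {i} (suc m) i≤s = begin
    prune G (i + suc m * s) (procedure G s i m)    ≡⟨ cong (prune G (i + suc m * s)) (procedure≡greedy m i≤s) ⟩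
    prune G (i + suc m * s) (greedy (i + m * s))   ≡⟨ cong (λ d → prune G d (greedy (i + m * s))) shift ⟩
    prune G (i + m * s + s) (greedy (i + m * s))   ≡⟨ sym (greedy-+s (i + m * s)) ⟩
    greedy (i + m * s + s)                          ≡⟨ cong greedy (sym shift) ⟩
    greedy (i + suc m * s)                          ∎
    where
    open ≡-Reasoning
    shift : i + suc m * s ≡ i + m * s + s
    shift = trans (cong (i +_) (+-comm s (m * s))) (sym (+-assoc i (m * s) s))

  greedyChain : ∀ ℓ → Nonempty (greedy ℓ) → DChain G s
  greedyChain ℓ (v , v∈) = record
    { len      = ℓ
    ; set      = greedy
    ; first    = refl
    ; nonempty = λ i i≤ℓ → v , greedy-antitone i≤ℓ v∈
    ; induced  = λ i _ → greedy-suc-⊆ i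
    ; degree   = λ i _ v → greedy-degree
    }

  ⊆-greedy : (L : DChain G s) → ∀ j → j ≤ len L → set L j ⊆ greedy j
  ⊆-greedy L = <-rec _ below
    where
    below : ∀ j → (∀ {i} → i < j → i ≤ len L → set L i ⊆ greedy i) → j ≤ len L → set L j ⊆ greedy j
    below zero    _   _    _  = ∈⊤
    below (suc j) rec 1+j≤ v∈ =
      ∈-greedy-suc⁺ (rec {j} ≤-refl j≤ (induced L j 1+j≤ v∈))
                    (≤-trans (degree L (suc j) 1+j≤ _ v∈) (degIn-mono G (rec (s≤s (m∸n≤m j s′)) j∸s′≤)))
      where
      j≤ = ≤-trans (n≤1+n j) 1+j≤
      j∸s′≤ = ≤-trans (m∸n≤m j s′) j≤

  greedy-len-nonempty : (L : DChain G s) → Nonempty (greedy (len L))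
  greedy-len-nonempty L with nonempty L (len L) ≤-refl
  ... | v , v∈ = v , ⊆-greedy L (len L) ≤-refl v∈

  module _ {L : DChain G s} (M : Maximal L) where

    set≡greedy : ∀ {k} → 1 ≤ k → k ≤ len L → set L k ≡ greedy k
    set≡greedy {k} 1≤k k≤len = ⊆-antisym (⊆-greedy L k k≤len) greedy⊆set
      where
      greedy⊆set : greedy k ⊆ set L k
      greedy⊆set {v} v∈ with v ∈? set L k
      ... | yes v∈L = v∈L
      ... | no  v∉L = ⊥-elim (noLarger M (greedyChain (len L) (greedy-len-nonempty L)) refl
                                        (k , 1≤k , k≤len , ⊆-greedy L k k≤len , v , v∈ , v∉L))

    greedy≡⊥ : ∀ {k} → len L < k → greedy k ≡ ⊥
    greedy≡⊥ {k} len<k = Empty-unique λ nonempty-k → <⇒≱ len<k (longest M (greedyChain k nonempty-k))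

theorem1 : ∀ {n} (G : Graph n) (s k m i : ℕ) → 1 ≤ s → 0 < k →
           1 ≤ i → i ≤ s → k ≡ i + m * s →
           (L : DChain G s) → Maximal L →
           (k ≤ len L → procedure G s i m ≡ set L k) ×
           (len L < k → procedure G s i m ≡ ⊥)
theorem1 G (suc s′) _ m i _ 0<k _ i≤s refl L M =
    (λ k≤len → trans (procedure≡greedy m i≤s) (sym (set≡greedy M 0<k k≤len)))
  , (λ len<k → trans (procedure≡greedy m i≤s) (greedy≡⊥ M len<k))
  where open Greedy G s′
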